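{- Let $\mathcal C$ be a fragment of first-order logic closed under the Boolean operations $\vee,\wedge,\neg$. Then for every query $\mathcal Q$ the following are equivalent: (a) there is a DynC-program (a dynamic program with update formulas in $\mathcal C$, absolute semantics) that maintains $\mathcal Q$; (b) there is a $\Delta$-DynC-program (a dynamic $\Delta$-program with update formulas in $\mathcal C$) that maintains $\mathcal Q$.
   Context: Dynamic complexity. A dynamic schema is a pair $(\tau_{in},\tau_{aux})$ of disjoint finite relational schemas; $\tau=\tau_{in}\cup\tau_{aux}$. A modification is $\mathrm{ins}_S(\vec a)$ or $\mathrm{del}_S(\vec a)$ for $S\in\tau_{in}$ and a tuple $\vec a$ of the arity of $S$. A state is $(D,\mathcal I,\mathcal A)$ with finite domain $D$, a $\tau_{in}$-database $\mathcal I$ and a $\tau_{aux}$-database $\mathcal A$. Absolute semantics: an update program assigns to every $R\in\tau_{aux}$ and $\delta\in\{\mathrm{ins}_S,\mathrm{del}_S : S\in\tau_{in}\}$ a first-order formula $\phi^R_\delta(\vec u;\vec x)$ over $\tau$; applying $\delta(\vec a)$ to $\mathcal S$ gives $(D,\delta(\mathcal I),\mathcal A')$ with $R^{\mathcal A'}=\{\vec b:\mathcal S\models\phi^R_\delta(\vec a;\vec b)\}$. $\Delta$-semantics: a $\Delta$-update program assigns two formulas $\phi^{R^+}_\delta(\vec u;\vec x)$, $\phi^{R^- }_\delta(\vec u;\vec x)$ over $\tau$ with $\phi^{R^+}_\delta\wedge\phi^{R^- }_\delta$ unsatisfiable, and $R^{\mathcal A'}=(R^{\mathcal A}\cup\{\vec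 b:\mathcal S\models\phi^{R^+}_\delta(\vec a;\vec b)\})\setminus\{\vec b:\mathcal S\models\phi^{R^- }_\delta(\vec a;\vec b)\}$. A (resp. $\Delta$-)dynamic program is $(P,\mathrm{Init},Q)$ with $P$ a (resp. $\Delta$-)update program, $\mathrm{Init}$ an arbitrary mapping from $\tau_{in}$-databases to $\tau_{aux}$-databases over the same domain, and $Q\in\tau_{aux}$; it maintains $\mathcal Q$ if for every $\tau_{in}$-database $\mathcal D$ with domain $D$ and every finite modification sequence $\alpha$, $\mathcal Q(\alpha(\mathcal D))$ equals the interpretation of $Q$ in the state obtained from $(D,\mathcal D,\mathrm{Init}(\mathcal D))$ by applying $\alpha$. -}

module Defs where

open import Data.Nat using (ℕ; zero; suc; _+_)
open import Data.Fin using (Fin; zero; suc; _≟_)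
open import Data.Vec using (Vec; []; _∷_; _++_)
open import Data.Vec.Properties using (≡-dec)
open import Data.Bool using (Bool; true; false; _∧_; _∨_; not)
open import Data.Product using (Σ; _×_; _,_)
open import Data.Sum using (_⊎_; inj₁; inj₂)
open import Data.List using (List; []; _∷_)
open import Relation.Nullary using (yes; no)
open import Relation.Nullary.Decidable using (⌊_⌋)
open import Relation.Binary.PropositionalEquality using (_≡_; refl; subst)

-- Sym = relation symbols, ar = their arities; n = number of free
-- variables (de Bruijn style, variable 0 is the most recently bound).

data Formula {Sym : Set} (ar : Sym → ℕ) (n : ℕ) : Set where
  atom : (R : Sym) → Vec (Fin n) (ar R) → Formula ar n
  _≐_  : Fin n → Fin n → Formula ar n
  ¬'_  : Formula ar n → Formula ar n
  _∧'_ : Formula ar n → Formula ar n → Formula ar n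
  _∨'_ : Formula ar n → Formula ar n → Formula ar n
  ∃'   : Formula ar (suc n) → Formula ar n
  ∀'   : Formula ar (suc n) → Formula ar n

Structure : {Sym : Set} → (Sym → ℕ) → ℕ → Set
Structure {Sym} ar k = (R : Sym) → Vec (Fin k) (ar R) → Bool

anyFin : (k : ℕ) → (Fin k → Bool) → Bool
anyFin zero    f = false
anyFin (suc k) f = f zero ∨ anyFin k (λ i → f (suc i))

allFin : (k : ℕ) → (Fin k → Bool) → Bool
allFin zero    f = true
allFin (suc k) f = f zero ∧ allFin k (λ i → f (suc i))

lookupV : {A : Set} {n : ℕ} → Vec A n → Fin n → A
lookupV (x ∷ xs) zero    = x
lookupV (x ∷ xs) (suc i) = lookupV xs i

mapV : {A B : Set} {n : ℕ} → (A → B) → Vec A n → Vec B n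
mapV f []       = []
mapV f (x ∷ xs) = f x ∷ mapV f xs

⟦_⟧ : {Sym : Set} {ar : Sym → ℕ} {n k : ℕ} →
      Formula ar n → Structure ar k → Vec (Fin k) n → Bool
⟦ atom R v ⟧ 𝔄 ρ = 𝔄 R (mapV (lookupV ρ) v)
⟦ i ≐ j ⟧    𝔄 ρ = ⌊ lookupV ρ i ≟ lookupV ρ j ⌋
⟦ ¬' φ ⟧     𝔄 ρ = not (⟦ φ ⟧ 𝔄 ρ)
⟦ φ ∧' ψ ⟧   𝔄 ρ = ⟦ φ ⟧ 𝔄 ρ ∧ ⟦ ψ ⟧ 𝔄 ρ
⟦ φ ∨' ψ ⟧   𝔄 ρ = ⟦ φ ⟧ 𝔄 ρ ∨ ⟦ ψ ⟧ 𝔄 ρ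
⟦_⟧ {k = k} (∃' φ) 𝔄 ρ = anyFin k (λ d → ⟦ φ ⟧ 𝔄 (d ∷ ρ))
⟦_⟧ {k = k} (∀' φ) 𝔄 ρ = allFin k (λ d → ⟦ φ ⟧ 𝔄 (d ∷ ρ))

Fragment : Set₁
Fragment = {Sym : Set} {ar : Sym → ℕ} {n : ℕ} → Formula ar n → Set

BooleanClosed : Fragment → Set₁
BooleanClosed C =
  ({Sym : Set} {ar : Sym → ℕ} {n : ℕ} {φ ψ : Formula ar n} →
     C φ → C ψ → C (φ ∧' ψ)) ×
  ({Sym : Set} {ar : Sym → ℕ} {n : ℕ} {φ ψ : Formula ar n} →
     C φ → C ψ → C (φ ∨' ψ)) ×
  ({Sym : Set} {ar : Sym → ℕ} {n : ℕ} {φ : Formula ar n} →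
     C φ → C (¬' φ))

ContainsAtoms : Fragment → Set₁
ContainsAtoms C = {Sym : Set} {ar : Sym → ℕ} {n : ℕ} →
  (R : Sym) (v : Vec (Fin n) (ar R)) → C (atom {ar = ar} R v)

record Schema : Set where
  constructor schema
  field
    size : ℕ
    ar   : Fin size → ℕ
open Schema public

DB : Schema → ℕ → Set
DB σ k = (S : Fin (size σ)) → Vec (Fin k) (ar σ S) → Bool

τSym : Schema → Schema → Set
τSym τin τaux = Fin (size τin) ⊎ Fin (size τaux)

τar : (τin τaux : Schema) → τSym τin τaux → ℕ
τar τin τaux (inj₁ S) = ar τin S
τar τin τaux (inj₂ R) = ar τaux R

stateStr : {τin τaux : Schema} {k : ℕ} →
           DB τin k → DB τaux k → Structure (τar τin τaux) k
stateStr I A (inj₁ S) = I S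
stateStr I A (inj₂ R) = A R

data Kind : Set where
  ins del : Kind

record Mod (σ : Schema) (k : ℕ) : Set where
  constructor mod
  field
    kind : Kind
    sym  : Fin (size σ)
    tup  : Vec (Fin k) (ar σ sym)

sameTuple : {σ : Schema} {k : ℕ} (S : Fin (size σ)) → Vec (Fin k) (ar σ S) →
            (S' : Fin (size σ)) → Vec (Fin k) (ar σ S') → Bool
sameTuple S a S' b with S' ≟ S
... | yes refl = ⌊ ≡-dec _≟_ b a ⌋
... | no _     = false

applyMod : {σ : Schema} {k : ℕ} → Mod σ k → DB σ k → DB σ k
applyMod (mod ins S a) I S' b = I S' b ∨ sameTuple S a S' b
applyMod (mod del S a) I S' b = I S' b ∧ not (sameTuple S a S' b)

applySeq : {σ : Schema} {k : ℕ} → List (Mod σ k) → DB σ k → DB σ k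
applySeq []       I = I
applySeq (m ∷ ms) I = applySeq ms (applyMod m I)

-- Update programs.  The update formula φ^R_δ(u ; x) for δ ∈ {ins_S, del_S}
-- has free variables u (first, ar S many) followed by x (ar R many).

UFormula : (τin τaux : Schema) → Fin (size τin) → Fin (size τaux) → Set
UFormula τin τaux S R = Formula (τar τin τaux) (ar τin S + ar τaux R)

UpdateProgram : Schema → Schema → Set
UpdateProgram τin τaux =
  (R : Fin (size τaux)) → Kind → (S : Fin (size τin)) → UFormula τin τaux S R

Unsat : {Sym : Set} {ar : Sym → ℕ} {n : ℕ} → Formula ar n → Set
Unsat {ar = ar} {n} φ = (k : ℕ) (𝔄 : Structure ar k) (ρ : Vec (Fin k) n) → ⟦ φ ⟧ 𝔄 ρ ≡ false

record ΔUpdateProgram (τin τaux : Schema) : Set where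
  field
    φ⁺ : (R : Fin (size τaux)) → Kind → (S : Fin (size τin)) → UFormula τin τaux S R
    φ⁻ : (R : Fin (size τaux)) → Kind → (S : Fin (size τin)) → UFormula τin τaux S R
    disjoint : (R : Fin (size τaux)) (κ : Kind) (S : Fin (size τin)) →
               Unsat (φ⁺ R κ S ∧' φ⁻ R κ S)
open ΔUpdateProgram public

record State (τin τaux : Schema) (k : ℕ) : Set where
  constructor st
  field
    inp : DB τin k
    aux : DB τaux k
open State public

step : {τin τaux : Schema} {k : ℕ} → UpdateProgram τin τaux →
       Mod τin k → State τin τaux k → State τin τaux k
step P (mod κ S a) (st I A) =
  st (applyMod (mod κ S a) I) (λ R b → ⟦ P R κ S ⟧ (stateStr I A) (a ++ b))

Δstep : {τin τaux : Schema} {k : ℕ} → ΔUpdateProgram τin τaux →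
        Mod τin k → State τin τaux k → State τin τaux k
Δstep P (mod κ S a) (st I A) =
  st (applyMod (mod κ S a) I)
     (λ R b → (A R b ∨ ⟦ φ⁺ P R κ S ⟧ (stateStr I A) (a ++ b))
              ∧ not (⟦ φ⁻ P R κ S ⟧ (stateStr I A) (a ++ b)))

run : {τin τaux : Schema} {k : ℕ} → UpdateProgram τin τaux →
      List (Mod τin k) → State τin τaux k → State τin τaux k
run P []       s = s
run P (m ∷ ms) s = run P ms (step P m s)

Δrun : {τin τaux : Schema} {k : ℕ} → ΔUpdateProgram τin τaux →
       List (Mod τin k) → State τin τaux k → State τin τaux k
Δrun P []       s = s
Δrun P (m ∷ ms) s = Δrun P ms (Δstep P m s)

Query : Schema → ℕ → Set
Query τin r = (k : ℕ) → DB τin k → Vec (Fin k) r → Bool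

InitMap : Schema → Schema → Set
InitMap τin τaux = (k : ℕ) → DB τin k → DB τaux k

record DynProgram (τin τaux : Schema) : Set where
  field
    prog : UpdateProgram τin τaux
    init : InitMap τin τaux
    qsym : Fin (size τaux)
open DynProgram public

record ΔDynProgram (τin τaux : Schema) : Set where
  field
    Δprog : ΔUpdateProgram τin τaux
    Δinit : InitMap τin τaux
    Δqsym : Fin (size τaux)
open ΔDynProgram public

InFragment : Fragment → {τin τaux : Schema} → DynProgram τin τaux → Set
InFragment C {τin} {τaux} 𝒫 =
  (R : Fin (size τaux)) (κ : Kind) (S : Fin (size τin)) → C (prog 𝒫 R κ S)

ΔInFragment : Fragment → {τin τaux : Schema} → ΔDynProgram τin τaux → Set
ΔInFragment C {τin} {τaux} 𝒫 =
  (R : Fin (size τaux)) (κ : Kind) (S : Fin (size τin)) →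
  C (φ⁺ (Δprog 𝒫) R κ S) × C (φ⁻ (Δprog 𝒫) R κ S)

Maintains : {τin τaux : Schema} {r : ℕ} → DynProgram τin τaux → Query τin r → Set
Maintains {τin} {τaux} {r} 𝒫 𝒬 =
  Σ (ar τaux (qsym 𝒫) ≡ r) λ p →
    (k : ℕ) (D : DB τin k) (α : List (Mod τin k)) (b : Vec (Fin k) (ar τaux (qsym 𝒫))) →
    𝒬 k (applySeq α D) (subst (Vec (Fin k)) p b)
      ≡ aux (run (prog 𝒫) α (st D (init 𝒫 k D))) (qsym 𝒫) b

ΔMaintains : {τin τaux : Schema} {r : ℕ} → ΔDynProgram τin τaux → Query τin r → Set
ΔMaintains {τin} {τaux} {r} 𝒫 𝒬 =
  Σ (ar τaux (Δqsym 𝒫) ≡ r) λ p →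
    (k : ℕ) (D : DB τin k) (α : List (Mod τin k)) (b : Vec (Fin k) (ar τaux (Δqsym 𝒫))) →
    𝒬 k (applySeq α D) (subst (Vec (Fin k)) p b)
      ≡ aux (Δrun (Δprog 𝒫) α (st D (Δinit 𝒫 k D))) (Δqsym 𝒫) b

-- Both semantics can express each other's updates with one Boolean
-- combination.  An absolute update φ becomes the Δ-update (φ⁺, φ⁻) = (φ, ¬φ),
-- whose disjointness is x ∧ ¬x = false; a Δ-update (φ⁺, φ⁻) becomes the
-- absolute update (R(x) ∨ φ⁺) ∧ ¬φ⁻, where R(x) reads the old value of R.
-- Translated programs agree after every single modification, hence after
-- every modification sequence, with the same Init and query symbol.
module Submission where

open import Defs
open import Data.Nat using (ℕ; zero; suc; _+_)
open import Data.Fin using (Fin; zero; suc; _↑ʳ_)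
open import Data.Vec using (Vec; []; _∷_; _++_; map; lookup)
open import Data.Vec.Properties using (map-cong; map-∘; lookup-++ʳ; map-lookup-allFin)
open import Data.Bool using (Bool; _∧_; _∨_; not)
open import Data.Bool.Properties using (not-involutive; ∧-comm; ∨-comm; ∧-abs-∨; ∧-inverseʳ)
open import Data.Sum using (inj₁; inj₂)
open import Data.List using (List; []; _∷_)
open import Data.Product using (Σ; _×_; _,_; proj₁; proj₂)
open import Function.Bundles using (_⇔_; mk⇔)
open import Relation.Binary.PropositionalEquality
  using (_≡_; refl; sym; trans; cong; cong₂; _≗_; module ≡-Reasoning)

import Data.Vec as Vec

NegationClosed : Fragment → Set₁
NegationClosed C = {Sym : Set} {ar : Sym → ℕ} {n : ℕ} {φ : Formula ar n} →
  C φ → C (¬' φ)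

anyFin-cong : (k : ℕ) {f g : Fin k → Bool} → f ≗ g → anyFin k f ≡ anyFin k g
anyFin-cong zero    f≗g = refl
anyFin-cong (suc k) f≗g = cong₂ _∨_ (f≗g zero) (anyFin-cong k (λ i → f≗g (suc i)))

allFin-cong : (k : ℕ) {f g : Fin k → Bool} → f ≗ g → allFin k f ≡ allFin k g
allFin-cong zero    f≗g = refl
allFin-cong (suc k) f≗g = cong₂ _∧_ (f≗g zero) (allFin-cong k (λ i → f≗g (suc i)))

⟦⟧-cong : {Sym : Set} {ar : Sym → ℕ} {n k : ℕ} {𝔄 𝔅 : Structure ar k} →
  (∀ R → 𝔄 R ≗ 𝔅 R) → (φ : Formula ar n) → ⟦ φ ⟧ 𝔄 ≗ ⟦ φ ⟧ 𝔅
⟦⟧-cong 𝔄≗𝔅 (atom R v) ρ = 𝔄≗𝔅 R _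
⟦⟧-cong 𝔄≗𝔅 (i ≐ j)    ρ = refl
⟦⟧-cong 𝔄≗𝔅 (¬' φ)     ρ = cong not (⟦⟧-cong 𝔄≗𝔅 φ ρ)
⟦⟧-cong 𝔄≗𝔅 (φ ∧' ψ)   ρ = cong₂ _∧_ (⟦⟧-cong 𝔄≗𝔅 φ ρ) (⟦⟧-cong 𝔄≗𝔅 ψ ρ)
⟦⟧-cong 𝔄≗𝔅 (φ ∨' ψ)   ρ = cong₂ _∨_ (⟦⟧-cong 𝔄≗𝔅 φ ρ) (⟦⟧-cong 𝔄≗𝔅 ψ ρ)
⟦⟧-cong {k = k} 𝔄≗𝔅 (∃' φ) ρ = anyFin-cong k (λ d → ⟦⟧-cong 𝔄≗𝔅 φ (d ∷ ρ))
⟦⟧-cong {k = k} 𝔄≗𝔅 (∀' φ) ρ = allFin-cong k (λ d → ⟦⟧-cong 𝔄≗𝔅 φ (d ∷ ρ))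

mapV≗map : {A B : Set} {n : ℕ} (f : A → B) → mapV {n = n} f ≗ map f
mapV≗map f []       = refl
mapV≗map f (x ∷ xs) = cong (f x ∷_) (mapV≗map f xs)

lookupV≗lookup : {A : Set} {n : ℕ} (xs : Vec A n) → lookupV xs ≗ lookup xs
lookupV≗lookup (x ∷ xs) zero    = refl
lookupV≗lookup (x ∷ xs) (suc i) = lookupV≗lookup xs i

suffixVars : (m n : ℕ) → Vec (Fin (m + n)) n
suffixVars m n = map (m ↑ʳ_) (Vec.allFin n)

lookup-suffixVars : {A : Set} {m n : ℕ} (a : Vec A m) (b : Vec A n) →
  mapV (lookupV (a ++ b)) (suffixVars m n) ≡ b
lookup-suffixVars {m = m} {n} a b = begin
  mapV (lookupV (a ++ b)) (suffixVars m n)          ≡⟨ mapV≗map _ _ ⟩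
  map (lookupV (a ++ b)) (suffixVars m n)           ≡⟨ map-cong (lookupV≗lookup (a ++ b)) _ ⟩
  map (lookup (a ++ b)) (map (m ↑ʳ_) (Vec.allFin n)) ≡⟨ map-∘ _ _ _ ⟨
  map (λ i → lookup (a ++ b) (m ↑ʳ i)) (Vec.allFin n) ≡⟨ map-cong (lookup-++ʳ a b) _ ⟩
  map (lookup b) (Vec.allFin n)                     ≡⟨ map-lookup-allFin b ⟩
  b                                                 ∎
  where open ≡-Reasoning

record _≋_ {τin τaux : Schema} {k : ℕ} (s t : State τin τaux k) : Set where
  field
    inp≗ : ∀ S → inp s S ≗ inp t S
    aux≗ : ∀ R → aux s R ≗ aux t R
open _≋_

≋-refl : {τin τaux : Schema} {k : ℕ} {s : State τin τaux k} → s ≋ s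
≋-refl = record { inp≗ = λ _ _ → refl ; aux≗ = λ _ _ → refl }

≋-trans : {τin τaux : Schema} {k : ℕ} {s t u : State τin τaux k} → s ≋ t → t ≋ u → s ≋ u
≋-trans s≋t t≋u = record
  { inp≗ = λ S v → trans (inp≗ s≋t S v) (inp≗ t≋u S v)
  ; aux≗ = λ R v → trans (aux≗ s≋t R v) (aux≗ t≋u R v) }

applyMod-cong : {σ : Schema} {k : ℕ} (m : Mod σ k) {I J : DB σ k} →
  (∀ S → I S ≗ J S) → ∀ S → applyMod m I S ≗ applyMod m J S
applyMod-cong (mod ins S a) I≗J S' b = cong (_∨ sameTuple S a S' b) (I≗J S' b)
applyMod-cong (mod del S a) I≗J S' b = cong (_∧ not (sameTuple S a S' b)) (I≗J S' b)

stateStr-cong : {τin τaux : Schema} {k : ℕ} {s t : State τin τaux k} → s ≋ t →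
  ∀ R → stateStr (inp s) (aux s) R ≗ stateStr (inp t) (aux t) R
stateStr-cong s≋t (inj₁ S) = inp≗ s≋t S
stateStr-cong s≋t (inj₂ R) = aux≗ s≋t R

step-cong : {τin τaux : Schema} {k : ℕ} (P : UpdateProgram τin τaux) (m : Mod τin k)
  {s t : State τin τaux k} → s ≋ t → step P m s ≋ step P m t
step-cong P (mod κ S a) s≋t = record
  { inp≗ = applyMod-cong (mod κ S a) (inp≗ s≋t)
  ; aux≗ = λ R b → ⟦⟧-cong (stateStr-cong s≋t) (P R κ S) (a ++ b) }

-- Both steps apply the same modification to the input, so only the
-- auxiliary relations have to be compared.
record AgreeOnSteps {τin τaux : Schema}
                    (P : UpdateProgram τin τaux) (P′ : ΔUpdateProgram τin τaux) : Set where
  constructor agreeOnSteps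
  field
    aux-step≗aux-Δstep : ∀ {k} κ S a (I : DB τin k) (A : DB τaux k) R →
      aux (step P (mod κ S a) (st I A)) R ≗ aux (Δstep P′ (mod κ S a) (st I A)) R
open AgreeOnSteps

step≋Δstep : {τin τaux : Schema} {k : ℕ} {P : UpdateProgram τin τaux} {P′ : ΔUpdateProgram τin τaux} →
  AgreeOnSteps P P′ → (m : Mod τin k) (s : State τin τaux k) → step P m s ≋ Δstep P′ m s
step≋Δstep agree (mod κ S a) s = record
  { inp≗ = λ _ _ → refl ; aux≗ = aux-step≗aux-Δstep agree κ S a (inp s) (aux s) }

run≋Δrun : {τin τaux : Schema} {k : ℕ} {P : UpdateProgram τin τaux} {P′ : ΔUpdateProgram τin τaux} →
  AgreeOnSteps P P′ → (α : List (Mod τin k)) {s t : State τin τaux k} →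
  s ≋ t → run P α s ≋ Δrun P′ α t
run≋Δrun agree []      s≋t = s≋t
run≋Δrun {P = P} agree (m ∷ α) {t = t} s≋t =
  run≋Δrun agree α (≋-trans (step-cong P m s≋t) (step≋Δstep agree m t))

asΔ : {τin τaux : Schema} → UpdateProgram τin τaux → ΔUpdateProgram τin τaux
asΔ P = record
  { φ⁺ = P
  ; φ⁻ = λ R κ S → ¬' P R κ S
  ; disjoint = λ R κ S k 𝔄 ρ → ∧-inverseʳ (⟦ P R κ S ⟧ 𝔄 ρ) }

fromΔ : {τin τaux : Schema} → ΔUpdateProgram τin τaux → UpdateProgram τin τaux
fromΔ {τin} {τaux} P R κ S =
  (atom (inj₂ R) (suffixVars (ar τin S) (ar τaux R)) ∨' φ⁺ P R κ S) ∧' (¬' φ⁻ P R κ S)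

∨-∧-not-not : (x y : Bool) → (x ∨ y) ∧ not (not y) ≡ y
∨-∧-not-not x y = begin
  (x ∨ y) ∧ not (not y) ≡⟨ cong ((x ∨ y) ∧_) (not-involutive y) ⟩
  (x ∨ y) ∧ y           ≡⟨ ∧-comm (x ∨ y) y ⟩
  y ∧ (x ∨ y)           ≡⟨ cong (y ∧_) (∨-comm x y) ⟩
  y ∧ (y ∨ x)           ≡⟨ ∧-abs-∨ y x ⟩
  y                     ∎
  where open ≡-Reasoning

asΔ-agrees : {τin τaux : Schema} (P : UpdateProgram τin τaux) → AgreeOnSteps P (asΔ P)
asΔ-agrees P = agreeOnSteps λ κ S a I A R b → sym (∨-∧-not-not (A R b) (⟦ P R κ S ⟧ (stateStr I A) (a ++ b)))

fromΔ-agrees : {τin τaux : Schema} (P : ΔUpdateProgram τin τaux) → AgreeOnSteps (fromΔ P) P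
fromΔ-agrees P = agreeOnSteps λ κ S a I A R b →
  cong (λ old → (A R old ∨ ⟦ φ⁺ P R κ S ⟧ (stateStr I A) (a ++ b))
                ∧ not (⟦ φ⁻ P R κ S ⟧ (stateStr I A) (a ++ b)))
       (lookup-suffixVars a b)

asΔDyn : {τin τaux : Schema} → DynProgram τin τaux → ΔDynProgram τin τaux
asΔDyn 𝒫 = record { Δprog = asΔ (prog 𝒫) ; Δinit = init 𝒫 ; Δqsym = qsym 𝒫 }

fromΔDyn : {τin τaux : Schema} → ΔDynProgram τin τaux → DynProgram τin τaux
fromΔDyn 𝒫 = record { prog = fromΔ (Δprog 𝒫) ; init = Δinit 𝒫 ; qsym = Δqsym 𝒫 }

asΔDyn-inFragment : (C : Fragment) → NegationClosed C →
  {τin τaux : Schema} (𝒫 : DynProgram τin τaux) → InFragment C 𝒫 → ΔInFragment C (asΔDyn 𝒫)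
asΔDyn-inFragment C ¬-closed 𝒫 𝒫∈C R κ S = 𝒫∈C R κ S , ¬-closed (𝒫∈C R κ S)

fromΔDyn-inFragment : (C : Fragment) → BooleanClosed C → ContainsAtoms C →
  {τin τaux : Schema} (𝒫 : ΔDynProgram τin τaux) → ΔInFragment C 𝒫 → InFragment C (fromΔDyn 𝒫)
fromΔDyn-inFragment C (∧-closed , ∨-closed , ¬-closed) atoms 𝒫 𝒫∈C R κ S =
  ∧-closed (∨-closed (atoms _ _) (proj₁ (𝒫∈C R κ S))) (¬-closed (proj₂ (𝒫∈C R κ S)))

asΔDyn-maintains : {τin τaux : Schema} {r : ℕ} {𝒬 : Query τin r} (𝒫 : DynProgram τin τaux) →
  Maintains 𝒫 𝒬 → ΔMaintains (asΔDyn 𝒫) 𝒬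
asΔDyn-maintains 𝒫 (ar≡r , maintains) = ar≡r , λ k D α b →
  trans (maintains k D α b)
        (aux≗ (run≋Δrun (asΔ-agrees (prog 𝒫)) α ≋-refl) (qsym 𝒫) b)

fromΔDyn-maintains : {τin τaux : Schema} {r : ℕ} {𝒬 : Query τin r} (𝒫 : ΔDynProgram τin τaux) →
  ΔMaintains 𝒫 𝒬 → Maintains (fromΔDyn 𝒫) 𝒬
fromΔDyn-maintains 𝒫 (ar≡r , maintains) = ar≡r , λ k D α b →
  trans (maintains k D α b)
        (sym (aux≗ (run≋Δrun (fromΔ-agrees (Δprog 𝒫)) α ≋-refl) (Δqsym 𝒫) b))

lemma4p4 : (C : Fragment) → BooleanClosed C → ContainsAtoms C →
    (τin : Schema) (r : ℕ) (𝒬 : Query τin r) →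
    (Σ Schema λ τaux → Σ (DynProgram τin τaux) λ 𝒫 → InFragment C 𝒫 × Maintains 𝒫 𝒬)
    ⇔
    (Σ Schema λ τaux → Σ (ΔDynProgram τin τaux) λ 𝒫 → ΔInFragment C 𝒫 × ΔMaintains 𝒫 𝒬)
lemma4p4 C closed@(_ , _ , ¬-closed) atoms τin r 𝒬 = mk⇔
  (λ (τaux , 𝒫 , 𝒫∈C , maintains) →
     τaux , asΔDyn 𝒫 ,
     asΔDyn-inFragment C ¬-closed 𝒫 𝒫∈C , asΔDyn-maintains {𝒬 = 𝒬} 𝒫 maintains)
  (λ (τaux , 𝒫 , 𝒫∈C , maintains) →
     τaux , fromΔDyn 𝒫 ,
     fromΔDyn-inFragment C closed atoms 𝒫 𝒫∈C , fromΔDyn-maintains {𝒬 = 𝒬} 𝒫 maintains)
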